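{- For all integers $N\ge 1$ and $n\ge 0$, $$\sum_{\substack{i_1+i_2+i_3=n\\ i_1,i_2,i_3\ge 0}}\binom{n}{i_1,i_2,i_3}\widehat E_{N,i_1}\widehat E_{N,i_2}\widehat E_{N,i_3}=\sum_{m=0}^n\sum_{k=0}^m\binom{n}{m}\binom{m}{k}\frac{(4N-m+2)(2N-k+1)}{2(2N+1)^2}\widehat E_{N,k}\,E_{N,n-m}\,E_{N,m-k}.$$
   Context: $\binom{n}{i_1,i_2,i_3}=\frac{n!}{i_1!i_2!i_3!}$. For an integer $N\ge 0$, the hypergeometric Euler numbers $E_{N,n}$ are defined by $\dfrac{1}{\sum_{m\ge 0}\frac{(2N)!}{(2N+2m)!}t^{2m}}=\sum_{n=0}^\infty E_{N,n}\frac{t^n}{n!}$ (the denominator equals ${}_1F_2(1;N+1,\tfrac{2N+1}{2};\tfrac{t^2}{4})$), and the complementary hypergeometric Euler numbers $\widehat E_{N,n}$ are defined by $$\frac{t^{2N+1}/(2N+1)!}{\sinh t-\sum_{m=0}^{N-1}t^{2m+1}/(2m+1)!}=\sum_{n=0}^\infty\widehat E_{N,n}\frac{t^n}{n!},$$ equivalently $1/\sum_{m\ge0}\frac{(2N+1)!}{(2N+2m+1)!}t^{2m}=\sum_n\widehat E_{N,n}t^n/n!$. -}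

module Defs where

open import Data.Nat as ℕ using (ℕ; zero; suc; _∸_; _!)
open import Data.Nat.Properties using (_!≢0; m*n≢0)
open import Data.Nat.Combinatorics using (_C_)
open import Data.Integer as ℤ using (ℤ; +_)
open import Data.Rational using (ℚ; _/_; _+_; _*_; -_; 0ℚ; 1ℚ)
open import Data.List using (List; []; _∷_; zipWith; applyUpTo; foldr)

sumTo : ℕ → (ℕ → ℚ) → ℚ
sumTo zero    f = f 0
sumTo (suc n) f = sumTo n f + f (suc n)

sumℚ : List ℚ → ℚ
sumℚ = foldr _+_ 0ℚ

-- Coefficients of the multiplicative inverse of a formal power series
-- c 0 + c 1 t + c 2 t^2 + ... with c 0 = 1:
-- b 0 = 1,  b n = - Σ_{j=1}^{n} c j * b (n - j).
-- recipList c n = [b n, b (n-1), ..., b 0]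
recipList : (ℕ → ℚ) → ℕ → List ℚ
recipList c zero    = 1ℚ ∷ []
recipList c (suc n) =
  let L = recipList c n in
  (- sumℚ (zipWith _*_ (applyUpTo (λ j → c (suc j)) (suc n)) L)) ∷ L

recip : (ℕ → ℚ) → ℕ → ℚ
recip c n with recipList c n
... | []    = 0ℚ
... | b ∷ _ = b

fact/ : ℕ → ℕ → ℚ
fact/ a b = _/_ (+ (a !)) (b !) {{b !≢0}}

-- power series  Σ_m (2N)!/(2N+2m)! t^{2m}  (coefficient of t^j)
seriesE : ℕ → ℕ → ℚ
seriesE N j with j ℕ.% 2
... | zero = fact/ (2 ℕ.* N) (2 ℕ.* N ℕ.+ j)
... | _    = 0ℚ

-- power series  Σ_m (2N+1)!/(2N+2m+1)! t^{2m}
seriesÊ : ℕ → ℕ → ℚ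
seriesÊ N j with j ℕ.% 2
... | zero = fact/ (2 ℕ.* N ℕ.+ 1) (2 ℕ.* N ℕ.+ 1 ℕ.+ j)
... | _    = 0ℚ

-- hypergeometric Euler numbers E_{N,n}: 1/seriesE = Σ E_{N,n} t^n/n!
E : ℕ → ℕ → ℚ
E N n = (+ (n !) / 1) * recip (seriesE N) n

Ê : ℕ → ℕ → ℚ
Ê N n = (+ (n !) / 1) * recip (seriesÊ N) n

multinom : ℕ → ℕ → ℕ → ℕ → ℚ
multinom n i₁ i₂ i₃ =
  _/_ (+ (n !)) ((i₁ ! ℕ.* i₂ !) ℕ.* i₃ !) {{m*n≢0 _ _ {{m*n≢0 _ _ {{i₁ !≢0}} {{i₂ !≢0}}}} {{i₃ !≢0}}}}

binom : ℕ → ℕ → ℚ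
binom n k = (+ (n C k)) / 1

LHS : ℕ → ℕ → ℚ
LHS N n = sumTo n λ i₁ → sumTo (n ∸ i₁) λ i₂ →
  multinom n i₁ i₂ (n ∸ i₁ ∸ i₂) * (Ê N i₁ * (Ê N i₂ * Ê N (n ∸ i₁ ∸ i₂)))

weight : ℕ → ℕ → ℕ → ℚ
weight N m k =
  _/_ ((+ (4 ℕ.* N ℕ.+ 2) ℤ.- + m) ℤ.* (+ (2 ℕ.* N ℕ.+ 1) ℤ.- + k))
    (2 ℕ.* (suc (2 ℕ.* N) ℕ.* suc (2 ℕ.* N)))
    {{m*n≢0 2 _ {{_}} {{m*n≢0 (suc (2 ℕ.* N)) (suc (2 ℕ.* N))}}}}

RHS : ℕ → ℕ → ℚ
RHS N n = sumTo n λ m → sumTo m λ k →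
  binom n m * binom m k * weight N m k * Ê N k * E N (n ∸ m) * E N (m ∸ k)

{-# OPTIONS --safe #-}

-- Up to the factor n!, Ê_{N,n} and E_{N,n} are the power series coefficients of u = 1/g and
-- v = 1/f, where g = Σ (2N+1)!/(2N+2m+1)! t^{2m} and f = Σ (2N)!/(2N+2m)! t^{2m}.  With
-- κ = 2N+1 and θ = t d/dt these series satisfy (κ + θ) g = κ f.  Since θ is a derivation and
-- θ(g u) = 0, this gives g · (κ − θ)u = κ f u, that is v · (κ − θ)u = κ u².  Applying 2κ − θ
-- to κ u² gives 2κ u · (κ − θ)u, so multiplying by v once more,
--   2κ² u³ = v · (2κ − θ)(v · (κ − θ)u).
-- Comparing coefficients of t^n/n! on both sides yields the multinomial and binomial sums.

module Submission where

open import Defs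
open import Data.Nat using (ℕ; _≥_)
open import Relation.Binary.PropositionalEquality using (_≡_)
open import Data.Rational using (ℚ)

open import Data.Nat as ℕ using (zero; suc; _∸_; _≤_; z≤n; _!)
import Data.Nat.Properties as ℕP
open import Data.Nat.Properties using (_!≢0; _!*_!≢0; m*n≢0)
import Data.Nat.Tactic.RingSolver as ℕ-Solver
open import Data.Nat.Combinatorics using (_C_; k![n∸k]!∣n!)
open import Data.Nat.Combinatorics.Specification using (nCk≡n!/k![n-k]!)
open import Data.Nat.DivMod using (m/n*n≡m)
open import Data.Integer as ℤ using (ℤ; +_)
import Data.Integer.Properties as ℤP
open import Data.Rational using (_+_; _*_; -_; _-_; 0ℚ; 1ℚ; _/_; toℚᵘ)
open import Data.Rational.Properties
import Data.Rational.Unnormalised as ℚᵘ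
import Data.Rational.Unnormalised.Properties as ℚᵘP
open import Data.Rational.Solver using (module +-*-Solver)
open import Algebra.Properties.Group +-0-group using (inverseʳ-unique)
open import Data.List using (zipWith; applyUpTo)
open import Function using (_∘_)
open import Relation.Binary.PropositionalEquality
  using (refl; sym; trans; cong; cong₂; subst; _≗_; module ≡-Reasoning)

open +-*-Solver using (solve; _:+_; _:*_; :-_; _:-_; _:=_)

fromℤ : ℤ → ℚ
fromℤ i = i / 1

fromℕ : ℕ → ℚ
fromℕ n = fromℤ (+ n)

toℚᵘ-/suc : ∀ i k → toℚᵘ (i / suc k) ℚᵘ.≃ ℚᵘ.mkℚᵘ i k
toℚᵘ-/suc i k = toℚᵘ-fromℚᵘ (ℚᵘ.mkℚᵘ i k)

fromℤ-homo-+ : ∀ i j → fromℤ (i ℤ.+ j) ≡ fromℤ i + fromℤ j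
fromℤ-homo-+ i j = toℚᵘ-injective (begin
    toℚᵘ (fromℤ (i ℤ.+ j))              ≈⟨ toℚᵘ-/suc (i ℤ.+ j) 0 ⟩
    ℚᵘ.mkℚᵘ (i ℤ.+ j) 0                 ≈⟨ ℚᵘ.*≡* (cong (ℤ._* + 1) (sym (cong₂ ℤ._+_ (ℤP.*-identityʳ i) (ℤP.*-identityʳ j)))) ⟩
    ℚᵘ.mkℚᵘ i 0 ℚᵘ.+ ℚᵘ.mkℚᵘ j 0         ≈⟨ ℚᵘP.+-cong (toℚᵘ-/suc i 0) (toℚᵘ-/suc j 0) ⟨
    toℚᵘ (fromℤ i) ℚᵘ.+ toℚᵘ (fromℤ j)   ≈⟨ toℚᵘ-homo-+ (fromℤ i) (fromℤ j) ⟨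
    toℚᵘ (fromℤ i + fromℤ j)            ∎)
  where open ℚᵘP.≃-Reasoning

fromℤ-homo-* : ∀ i j → fromℤ (i ℤ.* j) ≡ fromℤ i * fromℤ j
fromℤ-homo-* i j = toℚᵘ-injective (begin
    toℚᵘ (fromℤ (i ℤ.* j))              ≈⟨ toℚᵘ-/suc (i ℤ.* j) 0 ⟩
    ℚᵘ.mkℚᵘ (i ℤ.* j) 0                 ≈⟨ ℚᵘP.*-cong (toℚᵘ-/suc i 0) (toℚᵘ-/suc j 0) ⟨
    toℚᵘ (fromℤ i) ℚᵘ.* toℚᵘ (fromℤ j)   ≈⟨ toℚᵘ-homo-* (fromℤ i) (fromℤ j) ⟨
    toℚᵘ (fromℤ i * fromℤ j)            ∎)
  where open ℚᵘP.≃-Reasoning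

fromℤ-homo-sub : ∀ i j → fromℤ (i ℤ.- j) ≡ fromℤ i - fromℤ j
fromℤ-homo-sub i j = trans (fromℤ-homo-+ i (ℤ.- j)) (cong (λ x → fromℤ i + x) fromℤ-homo-neg)
  where
  fromℤ-homo-neg : fromℤ (ℤ.- j) ≡ - fromℤ j
  fromℤ-homo-neg = inverseʳ-unique (fromℤ j) (fromℤ (ℤ.- j))
    (trans (sym (fromℤ-homo-+ j (ℤ.- j))) (cong fromℤ (ℤP.+-inverseʳ j)))

fromℕ-homo-+ : ∀ m n → fromℕ (m ℕ.+ n) ≡ fromℕ m + fromℕ n
fromℕ-homo-+ m n = trans (cong fromℤ (ℤP.pos-+ m n)) (fromℤ-homo-+ (+ m) (+ n))

fromℕ-homo-* : ∀ m n → fromℕ (m ℕ.* n) ≡ fromℕ m * fromℕ n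
fromℕ-homo-* m n = trans (cong fromℤ (ℤP.pos-* m n)) (fromℤ-homo-* (+ m) (+ n))

i/d*d≡i : ∀ i d .{{_ : ℕ.NonZero d}} → (i / d) * fromℕ d ≡ fromℤ i
i/d*d≡i i (suc k) = toℚᵘ-injective (begin
    toℚᵘ ((i / suc k) * fromℕ (suc k))              ≈⟨ toℚᵘ-homo-* (i / suc k) (fromℕ (suc k)) ⟩
    toℚᵘ (i / suc k) ℚᵘ.* toℚᵘ (fromℕ (suc k))       ≈⟨ ℚᵘP.*-cong (toℚᵘ-/suc i k) (toℚᵘ-/suc (+ suc k) 0) ⟩
    ℚᵘ.mkℚᵘ i k ℚᵘ.* ℚᵘ.mkℚᵘ (+ suc k) 0             ≈⟨ ℚᵘ.*≡* (trans (ℤP.*-identityʳ _) (cong (λ d → i ℤ.* + d) (sym (ℕP.*-identityʳ (suc k))))) ⟩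
    ℚᵘ.mkℚᵘ i 0                                     ≈⟨ toℚᵘ-/suc i 0 ⟨
    toℚᵘ (fromℤ i)                                  ∎)
  where open ℚᵘP.≃-Reasoning

*-cancelʳ-fromℕ : ∀ d .{{_ : ℕ.NonZero d}} {x y} → x * fromℕ d ≡ y * fromℕ d → x ≡ y
*-cancelʳ-fromℕ d {x} {y} eq = trans (sym (undo x)) (trans (cong (_* (+ 1 / d)) eq) (undo y))
  where
  undo : ∀ z → z * fromℕ d * (+ 1 / d) ≡ z
  undo z = begin
    z * fromℕ d * (+ 1 / d)    ≡⟨ *-assoc z (fromℕ d) (+ 1 / d) ⟩
    z * (fromℕ d * (+ 1 / d))  ≡⟨ cong (z *_) (trans (*-comm (fromℕ d) (+ 1 / d)) (i/d*d≡i (+ 1) d)) ⟩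
    z * 1ℚ                     ≡⟨ *-identityʳ z ⟩
    z                          ∎
    where open ≡-Reasoning

sumTo-cong : ∀ n {f g : ℕ → ℚ} → (∀ i → i ≤ n → f i ≡ g i) → sumTo n f ≡ sumTo n g
sumTo-cong zero    f≡g = f≡g 0 z≤n
sumTo-cong (suc n) f≡g =
  cong₂ _+_ (sumTo-cong n (λ i i≤n → f≡g i (ℕP.m≤n⇒m≤1+n i≤n))) (f≡g (suc n) ℕP.≤-refl)

sumTo-distrib-+ : ∀ n f g → sumTo n (λ i → f i + g i) ≡ sumTo n f + sumTo n g
sumTo-distrib-+ zero    f g = refl
sumTo-distrib-+ (suc n) f g = trans (cong (_+ (f (suc n) + g (suc n))) (sumTo-distrib-+ n f g))
  (interchange (sumTo n f) (sumTo n g) (f (suc n)) (g (suc n)))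
  where
  interchange : ∀ a b c d → a + b + (c + d) ≡ a + c + (b + d)
  interchange = solve 4 (λ a b c d → a :+ b :+ (c :+ d) := a :+ c :+ (b :+ d)) refl

*-distribˡ-sumTo : ∀ c n f → c * sumTo n f ≡ sumTo n (λ i → c * f i)
*-distribˡ-sumTo c zero    f = refl
*-distribˡ-sumTo c (suc n) f = trans (*-distribˡ-+ c (sumTo n f) (f (suc n)))
  (cong (_+ c * f (suc n)) (*-distribˡ-sumTo c n f))

*-distribʳ-sumTo : ∀ c n f → sumTo n f * c ≡ sumTo n (λ i → f i * c)
*-distribʳ-sumTo c zero    f = refl
*-distribʳ-sumTo c (suc n) f = trans (*-distribʳ-+ c (sumTo n f) (f (suc n)))
  (cong (_+ f (suc n) * c) (*-distribʳ-sumTo c n f))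

sumTo-suc : ∀ n f → sumTo (suc n) f ≡ f 0 + sumTo n (f ∘ suc)
sumTo-suc zero    f = refl
sumTo-suc (suc n) f = trans (cong (_+ f (suc (suc n))) (sumTo-suc n f)) (+-assoc (f 0) _ _)

sumTo-reverse : ∀ n f → sumTo n f ≡ sumTo n (λ i → f (n ∸ i))
sumTo-reverse zero    f = refl
sumTo-reverse (suc n) f = begin
    sumTo (suc n) f                             ≡⟨ sumTo-suc n f ⟩
    f 0 + sumTo n (f ∘ suc)                     ≡⟨ +-comm (f 0) _ ⟩
    sumTo n (f ∘ suc) + f 0                     ≡⟨ cong (_+ f 0) (sumTo-reverse n (f ∘ suc)) ⟩
    sumTo n (λ i → f (suc (n ∸ i))) + f 0       ≡⟨ cong₂ _+_ (sumTo-cong n (λ i i≤n → cong f (sym (ℕP.+-∸-assoc 1 i≤n))))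
                                                             (cong f (sym (ℕP.n∸n≡0 n))) ⟩
    sumTo n (λ i → f (suc n ∸ i)) + f (suc n ∸ suc n) ∎
  where open ≡-Reasoning

sumTo-triangle : ∀ n (F : ℕ → ℕ → ℚ) →
  sumTo n (λ m → sumTo m (λ i → F i m)) ≡ sumTo n (λ i → sumTo (n ∸ i) (λ j → F i (i ℕ.+ j)))
sumTo-triangle zero    F = refl
sumTo-triangle (suc n) F = begin
    sumTo n (λ m → sumTo m (λ i → F i m)) + sumTo (suc n) (λ i → F i (suc n))
      ≡⟨ cong (_+ sumTo (suc n) (λ i → F i (suc n))) (sumTo-triangle n F) ⟩
    rows n + (sumTo n (λ i → F i (suc n)) + F (suc n) (suc n))
      ≡⟨ +-assoc (rows n) _ _ ⟨
    rows n + sumTo n (λ i → F i (suc n)) + F (suc n) (suc n)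
      ≡⟨ cong (_+ F (suc n) (suc n)) (sumTo-distrib-+ n (row n) (λ i → F i (suc n))) ⟨
    sumTo n (λ i → row n i + F i (suc n)) + F (suc n) (suc n)
      ≡⟨ cong₂ _+_ (sumTo-cong n extend-row) last-row ⟩
    sumTo n (row (suc n)) + row (suc n) (suc n)
      ∎
  where
  open ≡-Reasoning
  row : ℕ → ℕ → ℚ
  row m i = sumTo (m ∸ i) (λ j → F i (i ℕ.+ j))
  rows : ℕ → ℚ
  rows m = sumTo m (row m)
  last-row : F (suc n) (suc n) ≡ row (suc n) (suc n)
  last-row = trans (cong (F (suc n)) (sym (ℕP.+-identityʳ (suc n))))
                   (cong (λ l → sumTo l (λ j → F (suc n) (suc n ℕ.+ j))) (sym (ℕP.n∸n≡0 n)))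
  extend-row : ∀ i → i ≤ n → row n i + F i (suc n) ≡ row (suc n) i
  extend-row i i≤n rewrite ℕP.+-∸-assoc 1 i≤n =
    cong (λ k → row n i + F i k) (sym (trans (ℕP.+-suc i (n ∸ i)) (cong suc (ℕP.m+[n∸m]≡n i≤n))))

Seq : Set
Seq = ℕ → ℚ

infixl 7 _⋆_
infixr 8 _·_

_⋆_ : Seq → Seq → Seq
(a ⋆ b) n = sumTo n (λ i → a i * b (n ∸ i))

_·_ : ℚ → Seq → Seq
(c · a) n = c * a n

δ : Seq
δ zero    = 1ℚ
δ (suc _) = 0ℚ

⋆-congˡ : ∀ a {b c} → b ≗ c → a ⋆ b ≗ a ⋆ c
⋆-congˡ a b≗c n = sumTo-cong n (λ i _ → cong (a i *_) (b≗c (n ∸ i)))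

⋆-congʳ : ∀ {a b} c → a ≗ b → a ⋆ c ≗ b ⋆ c
⋆-congʳ c a≗b n = sumTo-cong n (λ i _ → cong (_* c (n ∸ i)) (a≗b i))

⋆-comm : ∀ a b → a ⋆ b ≗ b ⋆ a
⋆-comm a b n = trans (sumTo-reverse n (λ i → a i * b (n ∸ i)))
  (sumTo-cong n (λ i i≤n → trans (*-comm (a (n ∸ i)) _) (cong (λ j → b j * a (n ∸ i)) (ℕP.m∸[m∸n]≡n i≤n))))

⋆-assoc : ∀ a b c → (a ⋆ b) ⋆ c ≗ a ⋆ (b ⋆ c)
⋆-assoc a b c n = begin
    sumTo n (λ m → sumTo m (λ i → a i * b (m ∸ i)) * c (n ∸ m))
      ≡⟨ sumTo-cong n (λ m _ → *-distribʳ-sumTo (c (n ∸ m)) m _) ⟩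
    sumTo n (λ m → sumTo m (λ i → a i * b (m ∸ i) * c (n ∸ m)))
      ≡⟨ sumTo-triangle n (λ i m → a i * b (m ∸ i) * c (n ∸ m)) ⟩
    sumTo n (λ i → sumTo (n ∸ i) (λ j → a i * b (i ℕ.+ j ∸ i) * c (n ∸ (i ℕ.+ j))))
      ≡⟨ sumTo-cong n (λ i _ → trans (sumTo-cong (n ∸ i) (λ j _ → reindex i j)) (sym (*-distribˡ-sumTo (a i) (n ∸ i) _))) ⟩
    sumTo n (λ i → a i * sumTo (n ∸ i) (λ j → b j * c (n ∸ i ∸ j)))
      ∎
  where
  open ≡-Reasoning
  reindex : ∀ i j → a i * b (i ℕ.+ j ∸ i) * c (n ∸ (i ℕ.+ j)) ≡ a i * (b j * c (n ∸ i ∸ j))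
  reindex i j = trans (cong₂ (λ k l → a i * b k * c l) (ℕP.m+n∸m≡n i j) (sym (ℕP.∸-+-assoc n i j)))
                      (*-assoc (a i) _ _)

⋆-identityˡ : ∀ a → δ ⋆ a ≗ a
⋆-identityˡ a zero    = *-identityˡ (a 0)
⋆-identityˡ a (suc n) = begin
    sumTo (suc n) (λ i → δ i * a (suc n ∸ i))      ≡⟨ sumTo-suc n (λ i → δ i * a (suc n ∸ i)) ⟩
    1ℚ * a (suc n) + sumTo n (λ i → 0ℚ * a (n ∸ i)) ≡⟨ cong₂ _+_ (*-identityˡ (a (suc n))) vanish ⟩
    a (suc n) + 0ℚ                                  ≡⟨ +-identityʳ (a (suc n)) ⟩
    a (suc n)                                       ∎
  where
  open ≡-Reasoning
  vanish : sumTo n (λ i → 0ℚ * a (n ∸ i)) ≡ 0ℚ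
  vanish = trans (sym (*-distribˡ-sumTo 0ℚ n (λ i → a (n ∸ i)))) (*-zeroˡ (sumTo n (λ i → a (n ∸ i))))

⋆-identityʳ : ∀ a → a ⋆ δ ≗ a
⋆-identityʳ a n = trans (⋆-comm a δ n) (⋆-identityˡ a n)

·-⋆-assoc : ∀ c a b → (c · a) ⋆ b ≗ c · (a ⋆ b)
·-⋆-assoc c a b n = trans (sumTo-cong n (λ i _ → *-assoc c (a i) (b (n ∸ i))))
  (sym (*-distribˡ-sumTo c n (λ i → a i * b (n ∸ i))))

⋆-·-comm : ∀ c a b → a ⋆ (c · b) ≗ c · (a ⋆ b)
⋆-·-comm c a b n = trans (⋆-comm a (c · b) n) (trans (·-⋆-assoc c b a n) (cong (c *_) (⋆-comm b a n)))

-- 𝒟 c acts on coefficients as the operator c − t d/dt acts on power series.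
𝒟 : ℚ → Seq → Seq
𝒟 c a n = (c - fromℕ n) * a n

𝒟-congˡ : ∀ c {a b} → a ≗ b → 𝒟 c a ≗ 𝒟 c b
𝒟-congˡ c a≗b n = cong ((c - fromℕ n) *_) (a≗b n)

𝒟-δ : ∀ c → 𝒟 c δ ≗ c · δ
𝒟-δ c zero    = cong (_* 1ℚ) (+-identityʳ c)
𝒟-δ c (suc n) = trans (*-zeroʳ (c - fromℕ (suc n))) (sym (*-zeroʳ c))

𝒟-· : ∀ c k a → 𝒟 c (k · a) ≗ k · 𝒟 c a
𝒟-· c k a n = trans (sym (*-assoc x k (a n))) (trans (cong (_* a n) (*-comm x k)) (*-assoc k x (a n)))
  where
  x : ℚ
  x = c - fromℕ n

𝒟-leibniz : ∀ c d a b n → 𝒟 (c + d) (a ⋆ b) n ≡ (𝒟 c a ⋆ b) n + (a ⋆ 𝒟 d b) n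
𝒟-leibniz c d a b n = begin
    (c + d - fromℕ n) * sumTo n (λ i → a i * b (n ∸ i))
      ≡⟨ *-distribˡ-sumTo (c + d - fromℕ n) n (λ i → a i * b (n ∸ i)) ⟩
    sumTo n (λ i → (c + d - fromℕ n) * (a i * b (n ∸ i)))
      ≡⟨ sumTo-cong n split ⟩
    sumTo n (λ i → 𝒟 c a i * b (n ∸ i) + a i * 𝒟 d b (n ∸ i))
      ≡⟨ sumTo-distrib-+ n _ _ ⟩
    (𝒟 c a ⋆ b) n + (a ⋆ 𝒟 d b) n
      ∎
  where
  open ≡-Reasoning
  distribute : ∀ c d x y p q → (c + d - (x + y)) * (p * q) ≡ (c - x) * p * q + p * ((d - y) * q)
  distribute = solve 6 (λ c d x y p q →
    (c :+ d :- (x :+ y)) :* (p :* q) := (c :- x) :* p :* q :+ p :* ((d :- y) :* q)) refl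
  split : ∀ i → i ≤ n →
    (c + d - fromℕ n) * (a i * b (n ∸ i)) ≡ 𝒟 c a i * b (n ∸ i) + a i * 𝒟 d b (n ∸ i)
  split i i≤n = begin
    (c + d - fromℕ n) * (a i * b (n ∸ i))
      ≡⟨ cong (λ k → (c + d - fromℕ k) * (a i * b (n ∸ i))) (sym (ℕP.m+[n∸m]≡n i≤n)) ⟩
    (c + d - fromℕ (i ℕ.+ (n ∸ i))) * (a i * b (n ∸ i))
      ≡⟨ cong (λ x → (c + d - x) * (a i * b (n ∸ i))) (fromℕ-homo-+ i (n ∸ i)) ⟩
    (c + d - (fromℕ i + fromℕ (n ∸ i))) * (a i * b (n ∸ i))
      ≡⟨ distribute c d (fromℕ i) (fromℕ (n ∸ i)) (a i) (b (n ∸ i)) ⟩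
    𝒟 c a i * b (n ∸ i) + a i * 𝒟 d b (n ∸ i)
      ∎

recipList-sum : ∀ c (g : ℕ → ℚ) n →
  sumℚ (zipWith _*_ (applyUpTo g (suc n)) (recipList c n)) ≡ sumTo n (λ j → g j * recip c (n ∸ j))
recipList-sum c g zero    = +-identityʳ (g 0 * 1ℚ)
recipList-sum c g (suc n) =
  trans (cong (λ x → g 0 * recip c (suc n) + x) (recipList-sum c (g ∘ suc) n))
        (sym (sumTo-suc n (λ j → g j * recip c (suc n ∸ j))))

⋆-recipʳ : ∀ c → c 0 ≡ 1ℚ → c ⋆ recip c ≗ δ
⋆-recipʳ c c₀ zero    = cong (_* 1ℚ) c₀
⋆-recipʳ c c₀ (suc n) = begin
    sumTo (suc n) (λ i → c i * recip c (suc n ∸ i)) ≡⟨ sumTo-suc n (λ i → c i * recip c (suc n ∸ i)) ⟩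
    c 0 * recip c (suc n) + tail                    ≡⟨ cong₂ (λ x y → x * y + tail) c₀ (cong -_ (recipList-sum c (c ∘ suc) n)) ⟩
    1ℚ * (- tail) + tail                            ≡⟨ cancel tail ⟩
    0ℚ                                              ∎
  where
  open ≡-Reasoning
  tail : ℚ
  tail = sumTo n (λ j → c (suc j) * recip c (n ∸ j))
  cancel : ∀ x → 1ℚ * (- x) + x ≡ 0ℚ
  cancel x = trans (cong (_+ x) (*-identityˡ (- x))) (+-inverseˡ x)

module CubeOfReciprocal (κ : ℚ) (f g : Seq) (f₀ : f 0 ≡ 1ℚ) (g₀ : g 0 ≡ 1ℚ)
                        (κ+θ-g≡κf : ∀ j → (κ + fromℕ j) * g j ≡ κ * f j) where

  u v : Seq
  u = recip g
  v = recip f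

  u⋆g : u ⋆ g ≗ δ
  u⋆g n = trans (⋆-comm u g n) (⋆-recipʳ g g₀ n)

  f⋆u⋆v : f ⋆ u ⋆ v ≗ u
  f⋆u⋆v n = begin
    (f ⋆ u ⋆ v) n   ≡⟨ ⋆-congʳ v (⋆-comm f u) n ⟩
    (u ⋆ f ⋆ v) n   ≡⟨ ⋆-assoc u f v n ⟩
    (u ⋆ (f ⋆ v)) n ≡⟨ ⋆-congˡ u (⋆-recipʳ f f₀) n ⟩
    (u ⋆ δ) n       ≡⟨ ⋆-identityʳ u n ⟩
    u n             ∎
    where open ≡-Reasoning

  𝒟-g : 𝒟 (- κ) g ≗ (- κ) · f
  𝒟-g j = begin
    (- κ - fromℕ j) * g j    ≡⟨ negate (fromℕ j) (g j) ⟩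
    - ((κ + fromℕ j) * g j)  ≡⟨ cong -_ (κ+θ-g≡κf j) ⟩
    - (κ * f j)              ≡⟨ neg-distribˡ-* κ (f j) ⟩
    - κ * f j                ∎
    where
    open ≡-Reasoning
    negate : ∀ x y → (- κ - x) * y ≡ - ((κ + x) * y)
    negate = solve 3 (λ k x y → (:- k :- x) :* y := :- ((k :+ x) :* y)) refl κ

  g⋆𝒟u : g ⋆ 𝒟 κ u ≗ κ · (f ⋆ u)
  g⋆𝒟u n = begin
    (g ⋆ 𝒟 κ u) n       ≡⟨ inverseʳ-unique _ _ leibniz-on-g⋆u ⟩
    - (𝒟 (- κ) g ⋆ u) n ≡⟨ cong -_ (trans (⋆-congʳ u 𝒟-g n) (·-⋆-assoc (- κ) f u n)) ⟩
    - (- κ * (f ⋆ u) n) ≡⟨ double-negation κ ((f ⋆ u) n) ⟩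
    κ * (f ⋆ u) n       ∎
    where
    open ≡-Reasoning
    double-negation : ∀ k x → - (- k * x) ≡ k * x
    double-negation = solve 2 (λ k x → :- (:- k :* x) := k :* x) refl
    leibniz-on-g⋆u : (𝒟 (- κ) g ⋆ u) n + (g ⋆ 𝒟 κ u) n ≡ 0ℚ
    leibniz-on-g⋆u = begin
      (𝒟 (- κ) g ⋆ u) n + (g ⋆ 𝒟 κ u) n ≡⟨ 𝒟-leibniz (- κ) κ g u n ⟨
      𝒟 (- κ + κ) (g ⋆ u) n              ≡⟨ 𝒟-congˡ (- κ + κ) (⋆-recipʳ g g₀) n ⟩
      𝒟 (- κ + κ) δ n                    ≡⟨ 𝒟-δ (- κ + κ) n ⟩
      (- κ + κ) * δ n                    ≡⟨ cong (_* δ n) (+-inverseˡ κ) ⟩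
      0ℚ * δ n                           ≡⟨ *-zeroˡ (δ n) ⟩
      0ℚ                                 ∎

  𝒟u⋆v : 𝒟 κ u ⋆ v ≗ κ · (u ⋆ u)
  𝒟u⋆v n = begin
    (𝒟 κ u ⋆ v) n                 ≡⟨ ⋆-congʳ v (λ m → sym (⋆-identityˡ (𝒟 κ u) m)) n ⟩
    (δ ⋆ 𝒟 κ u ⋆ v) n             ≡⟨ ⋆-congʳ v (λ m → trans (⋆-congʳ (𝒟 κ u) (sym ∘ u⋆g) m) (⋆-assoc u g (𝒟 κ u) m)) n ⟩
    (u ⋆ (g ⋆ 𝒟 κ u) ⋆ v) n       ≡⟨ ⋆-congʳ v (⋆-congˡ u g⋆𝒟u) n ⟩
    (u ⋆ κ · (f ⋆ u) ⋆ v) n       ≡⟨ ⋆-congʳ v (⋆-·-comm κ u (f ⋆ u)) n ⟩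
    ((κ · (u ⋆ (f ⋆ u))) ⋆ v) n   ≡⟨ ·-⋆-assoc κ (u ⋆ (f ⋆ u)) v n ⟩
    κ * (u ⋆ (f ⋆ u) ⋆ v) n       ≡⟨ cong (κ *_) (trans (⋆-assoc u (f ⋆ u) v n) (⋆-congˡ u f⋆u⋆v n)) ⟩
    κ * (u ⋆ u) n                 ∎
    where open ≡-Reasoning

  𝒟[𝒟u⋆v] : 𝒟 (κ + κ) (𝒟 κ u ⋆ v) ≗ (κ + κ) · (u ⋆ 𝒟 κ u)
  𝒟[𝒟u⋆v] n = begin
    𝒟 (κ + κ) (𝒟 κ u ⋆ v) n                  ≡⟨ 𝒟-congˡ (κ + κ) 𝒟u⋆v n ⟩
    𝒟 (κ + κ) (κ · (u ⋆ u)) n                ≡⟨ 𝒟-· (κ + κ) κ (u ⋆ u) n ⟩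
    κ * 𝒟 (κ + κ) (u ⋆ u) n                  ≡⟨ cong (κ *_) (𝒟-leibniz κ κ u u n) ⟩
    κ * ((𝒟 κ u ⋆ u) n + (u ⋆ 𝒟 κ u) n)      ≡⟨ cong (λ x → κ * (x + (u ⋆ 𝒟 κ u) n)) (⋆-comm (𝒟 κ u) u n) ⟩
    κ * ((u ⋆ 𝒟 κ u) n + (u ⋆ 𝒟 κ u) n)      ≡⟨ double κ ((u ⋆ 𝒟 κ u) n) ⟩
    (κ + κ) * (u ⋆ 𝒟 κ u) n                  ∎
    where
    open ≡-Reasoning
    double : ∀ k x → k * (x + x) ≡ (k + k) * x
    double = solve 2 (λ k x → k :* (x :+ x) := (k :+ k) :* x) refl

  cube : 𝒟 (κ + κ) (𝒟 κ u ⋆ v) ⋆ v ≗ (κ + κ) · (κ · (u ⋆ (u ⋆ u)))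
  cube n = begin
    (𝒟 (κ + κ) (𝒟 κ u ⋆ v) ⋆ v) n    ≡⟨ ⋆-congʳ v 𝒟[𝒟u⋆v] n ⟩
    ((κ + κ) · (u ⋆ 𝒟 κ u) ⋆ v) n    ≡⟨ ·-⋆-assoc (κ + κ) (u ⋆ 𝒟 κ u) v n ⟩
    (κ + κ) * (u ⋆ 𝒟 κ u ⋆ v) n      ≡⟨ cong ((κ + κ) *_) (⋆-assoc u (𝒟 κ u) v n) ⟩
    (κ + κ) * (u ⋆ (𝒟 κ u ⋆ v)) n    ≡⟨ cong ((κ + κ) *_) (⋆-congˡ u 𝒟u⋆v n) ⟩
    (κ + κ) * (u ⋆ κ · (u ⋆ u)) n    ≡⟨ cong ((κ + κ) *_) (⋆-·-comm κ u (u ⋆ u) n) ⟩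
    (κ + κ) * (κ * (u ⋆ (u ⋆ u)) n)  ∎
    where open ≡-Reasoning

fact/-*-! : ∀ a b → fact/ a b * fromℕ (b !) ≡ fromℕ (a !)
fact/-*-! a b = i/d*d≡i (+ (a !)) (b !) {{b !≢0}}

fact/-self : ∀ a → fact/ a a ≡ 1ℚ
fact/-self a = *-cancelʳ-fromℕ (a !) {{a !≢0}} (trans (fact/-*-! a a) (sym (*-identityˡ _)))

fact/-suc : ∀ a b → fact/ (suc a) (suc b) * fromℕ (suc b) ≡ fromℕ (suc a) * fact/ a b
fact/-suc a b = *-cancelʳ-fromℕ (b !) {{b !≢0}} (begin
    fact/ (suc a) (suc b) * fromℕ (suc b) * fromℕ (b !)   ≡⟨ *-assoc (fact/ (suc a) (suc b)) (fromℕ (suc b)) (fromℕ (b !)) ⟩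
    fact/ (suc a) (suc b) * (fromℕ (suc b) * fromℕ (b !)) ≡⟨ cong (fact/ (suc a) (suc b) *_) (fromℕ-homo-* (suc b) (b !)) ⟨
    fact/ (suc a) (suc b) * fromℕ (suc b !)               ≡⟨ fact/-*-! (suc a) (suc b) ⟩
    fromℕ (suc a !)                                       ≡⟨ fromℕ-homo-* (suc a) (a !) ⟩
    fromℕ (suc a) * fromℕ (a !)                           ≡⟨ cong (fromℕ (suc a) *_) (fact/-*-! a b) ⟨
    fromℕ (suc a) * (fact/ a b * fromℕ (b !))             ≡⟨ *-assoc (fromℕ (suc a)) _ _ ⟨
    fromℕ (suc a) * fact/ a b * fromℕ (b !)               ∎)
  where open ≡-Reasoning

fact/-step : ∀ a j → (fromℕ (suc a) + fromℕ j) * fact/ (suc a) (suc a ℕ.+ j) ≡ fromℕ (suc a) * fact/ a (a ℕ.+ j)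
fact/-step a j = begin
    (fromℕ (suc a) + fromℕ j) * fact/ (suc a) (suc a ℕ.+ j) ≡⟨ cong (_* fact/ (suc a) (suc a ℕ.+ j)) (fromℕ-homo-+ (suc a) j) ⟨
    fromℕ (suc a ℕ.+ j) * fact/ (suc a) (suc a ℕ.+ j)       ≡⟨ *-comm (fromℕ (suc a ℕ.+ j)) _ ⟩
    fact/ (suc a) (suc (a ℕ.+ j)) * fromℕ (suc (a ℕ.+ j))   ≡⟨ fact/-suc a (a ℕ.+ j) ⟩
    fromℕ (suc a) * fact/ a (a ℕ.+ j)                       ∎
  where open ≡-Reasoning

κ : ℕ → ℚ
κ N = fromℕ (2 ℕ.* N ℕ.+ 1)

seriesE-zero : ∀ N → seriesE N 0 ≡ 1ℚ
seriesE-zero N = trans (cong (fact/ (2 ℕ.* N)) (ℕP.+-identityʳ (2 ℕ.* N))) (fact/-self (2 ℕ.* N))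

seriesÊ-zero : ∀ N → seriesÊ N 0 ≡ 1ℚ
seriesÊ-zero N = trans (cong (fact/ (2 ℕ.* N ℕ.+ 1)) (ℕP.+-identityʳ (2 ℕ.* N ℕ.+ 1))) (fact/-self (2 ℕ.* N ℕ.+ 1))

seriesÊ-seriesE : ∀ N j → (κ N + fromℕ j) * seriesÊ N j ≡ κ N * seriesE N j
seriesÊ-seriesE N j with j ℕ.% 2
... | zero  = subst (λ s → (fromℕ s + fromℕ j) * fact/ s (s ℕ.+ j) ≡ fromℕ s * fact/ (2 ℕ.* N) (2 ℕ.* N ℕ.+ j))
                    (ℕP.+-comm 1 (2 ℕ.* N)) (fact/-step (2 ℕ.* N) j)
... | suc _ = trans (*-zeroʳ (κ N + fromℕ j)) (sym (*-zeroʳ (κ N)))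

ê e : ℕ → Seq
ê N = recip (seriesÊ N)
e N = recip (seriesE N)

multinom-*-factorials : ∀ n a b c → multinom n a b c * (fromℕ (a !) * fromℕ (b !) * fromℕ (c !)) ≡ fromℕ (n !)
multinom-*-factorials n a b c = begin
    multinom n a b c * (fromℕ (a !) * fromℕ (b !) * fromℕ (c !))
      ≡⟨ cong (λ x → multinom n a b c * (x * fromℕ (c !))) (fromℕ-homo-* (a !) (b !)) ⟨
    multinom n a b c * (fromℕ (a ! ℕ.* b !) * fromℕ (c !))
      ≡⟨ cong (multinom n a b c *_) (fromℕ-homo-* (a ! ℕ.* b !) (c !)) ⟨
    multinom n a b c * fromℕ (a ! ℕ.* b ! ℕ.* c !)
      ≡⟨ i/d*d≡i (+ (n !)) (a ! ℕ.* b ! ℕ.* c !) {{m*n≢0 _ _ {{a !* b !≢0}} {{c !≢0}}}} ⟩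
    fromℕ (n !)
      ∎
  where open ≡-Reasoning

binom-*-factorials : ∀ {n k} → k ≤ n → binom n k * (fromℕ (k !) * fromℕ ((n ∸ k) !)) ≡ fromℕ (n !)
binom-*-factorials {n} {k} k≤n = begin
    binom n k * (fromℕ (k !) * fromℕ ((n ∸ k) !)) ≡⟨ cong (binom n k *_) (fromℕ-homo-* (k !) ((n ∸ k) !)) ⟨
    binom n k * fromℕ (k ! ℕ.* (n ∸ k) !)         ≡⟨ fromℕ-homo-* (n C k) _ ⟨
    fromℕ ((n C k) ℕ.* (k ! ℕ.* (n ∸ k) !))         ≡⟨ cong fromℕ C*factorials ⟩
    fromℕ (n !)                                   ∎
  where
  open ≡-Reasoning
  C*factorials : (n C k) ℕ.* (k ! ℕ.* (n ∸ k) !) ≡ n !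
  C*factorials = trans (cong (ℕ._* (k ! ℕ.* (n ∸ k) !)) (nCk≡n!/k![n-k]! k≤n))
                       (m/n*n≡m {{k !* (n ∸ k) !≢0}} (k![n∸k]!∣n! k≤n))

weight-denominator : ℕ → ℕ
weight-denominator N = 2 ℕ.* (suc (2 ℕ.* N) ℕ.* suc (2 ℕ.* N))

fromℕ-weight-denominator : ∀ N → fromℕ (weight-denominator N) ≡ (κ N + κ N) * κ N
fromℕ-weight-denominator N = begin
    fromℕ (weight-denominator N)                              ≡⟨ cong fromℕ (expand N) ⟩
    fromℕ ((2 ℕ.* N ℕ.+ 1 ℕ.+ (2 ℕ.* N ℕ.+ 1)) ℕ.* (2 ℕ.* N ℕ.+ 1)) ≡⟨ fromℕ-homo-* (2 ℕ.* N ℕ.+ 1 ℕ.+ (2 ℕ.* N ℕ.+ 1)) (2 ℕ.* N ℕ.+ 1) ⟩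
    fromℕ (2 ℕ.* N ℕ.+ 1 ℕ.+ (2 ℕ.* N ℕ.+ 1)) * κ N           ≡⟨ cong (_* κ N) (fromℕ-homo-+ (2 ℕ.* N ℕ.+ 1) (2 ℕ.* N ℕ.+ 1)) ⟩
    (κ N + κ N) * κ N                                         ∎
  where
  open ≡-Reasoning
  expand : ∀ N → 2 ℕ.* (suc (2 ℕ.* N) ℕ.* suc (2 ℕ.* N)) ≡ (2 ℕ.* N ℕ.+ 1 ℕ.+ (2 ℕ.* N ℕ.+ 1)) ℕ.* (2 ℕ.* N ℕ.+ 1)
  expand = ℕ-Solver.solve-∀

weight-*-denominator : ∀ N m k →
  weight N m k * fromℕ (weight-denominator N) ≡ (κ N + κ N - fromℕ m) * (κ N - fromℕ k)
weight-*-denominator N m k = begin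
    weight N m k * fromℕ (weight-denominator N)
      ≡⟨ i/d*d≡i ((+ (4 ℕ.* N ℕ.+ 2) ℤ.- + m) ℤ.* (+ (2 ℕ.* N ℕ.+ 1) ℤ.- + k)) (weight-denominator N) ⟩
    fromℤ ((+ (4 ℕ.* N ℕ.+ 2) ℤ.- + m) ℤ.* (+ (2 ℕ.* N ℕ.+ 1) ℤ.- + k))
      ≡⟨ fromℤ-homo-* (+ (4 ℕ.* N ℕ.+ 2) ℤ.- + m) (+ (2 ℕ.* N ℕ.+ 1) ℤ.- + k) ⟩
    fromℤ (+ (4 ℕ.* N ℕ.+ 2) ℤ.- + m) * fromℤ (+ (2 ℕ.* N ℕ.+ 1) ℤ.- + k)
      ≡⟨ cong₂ _*_ (fromℤ-homo-sub (+ (4 ℕ.* N ℕ.+ 2)) (+ m)) (fromℤ-homo-sub (+ (2 ℕ.* N ℕ.+ 1)) (+ k)) ⟩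
    (fromℕ (4 ℕ.* N ℕ.+ 2) - fromℕ m) * (κ N - fromℕ k)
      ≡⟨ cong (λ x → (x - fromℕ m) * (κ N - fromℕ k)) (trans (cong fromℕ (expand N)) (fromℕ-homo-+ (2 ℕ.* N ℕ.+ 1) (2 ℕ.* N ℕ.+ 1))) ⟩
    (κ N + κ N - fromℕ m) * (κ N - fromℕ k)
      ∎
  where
  open ≡-Reasoning
  expand : ∀ N → 4 ℕ.* N ℕ.+ 2 ≡ 2 ℕ.* N ℕ.+ 1 ℕ.+ (2 ℕ.* N ℕ.+ 1)
  expand = ℕ-Solver.solve-∀

LHS-⋆ : ∀ N n → LHS N n ≡ fromℕ (n !) * (ê N ⋆ (ê N ⋆ ê N)) n
LHS-⋆ N n = begin
    LHS N n
      ≡⟨ sumTo-cong n (λ i₁ _ → sumTo-cong (n ∸ i₁) (λ i₂ _ → term i₁ i₂ (n ∸ i₁ ∸ i₂))) ⟩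
    sumTo n (λ i₁ → sumTo (n ∸ i₁) (λ i₂ → fromℕ (n !) * u i₁ * (u i₂ * u (n ∸ i₁ ∸ i₂))))
      ≡⟨ sumTo-cong n (λ i₁ _ → trans (sym (*-distribˡ-sumTo (fromℕ (n !) * u i₁) (n ∸ i₁) (λ i₂ → u i₂ * u (n ∸ i₁ ∸ i₂)))) (*-assoc (fromℕ (n !)) (u i₁) ((u ⋆ u) (n ∸ i₁)))) ⟩
    sumTo n (λ i₁ → fromℕ (n !) * (u i₁ * (u ⋆ u) (n ∸ i₁)))
      ≡⟨ *-distribˡ-sumTo (fromℕ (n !)) n _ ⟨
    fromℕ (n !) * (u ⋆ (u ⋆ u)) n
      ∎
  where
  open ≡-Reasoning
  u : Seq
  u = ê N
  regroup : ∀ M A B C x y z → M * (A * x * (B * y * (C * z))) ≡ M * (A * B * C) * (x * (y * z))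
  regroup = solve 7 (λ M A B C x y z →
    M :* (A :* x :* (B :* y :* (C :* z))) := M :* (A :* B :* C) :* (x :* (y :* z))) refl
  term : ∀ a b c → multinom n a b c * (Ê N a * (Ê N b * Ê N c)) ≡ fromℕ (n !) * u a * (u b * u c)
  term a b c = begin
    multinom n a b c * (Ê N a * (Ê N b * Ê N c))
      ≡⟨ regroup (multinom n a b c) (fromℕ (a !)) (fromℕ (b !)) (fromℕ (c !)) (u a) (u b) (u c) ⟩
    multinom n a b c * (fromℕ (a !) * fromℕ (b !) * fromℕ (c !)) * (u a * (u b * u c))
      ≡⟨ cong (_* (u a * (u b * u c))) (multinom-*-factorials n a b c) ⟩
    fromℕ (n !) * (u a * (u b * u c))
      ≡⟨ *-assoc (fromℕ (n !)) (u a) _ ⟨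
    fromℕ (n !) * u a * (u b * u c)
      ∎

RHS-⋆ : ∀ N n → RHS N n * fromℕ (weight-denominator N)
                ≡ fromℕ (n !) * (𝒟 (κ N + κ N) (𝒟 (κ N) (ê N) ⋆ e N) ⋆ e N) n
RHS-⋆ N n = begin
    RHS N n * D
      ≡⟨ *-distribʳ-sumTo D n _ ⟩
    sumTo n (λ m → sumTo m (T m) * D)
      ≡⟨ sumTo-cong n (λ m m≤n → trans (*-distribʳ-sumTo D m (T m)) (sumTo-cong m (λ k k≤m → term m k m≤n k≤m))) ⟩
    sumTo n (λ m → sumTo m (λ k → outer m * (𝒟 c₁ u k * v (m ∸ k))))
      ≡⟨ sumTo-cong n (λ m _ → sym (*-distribˡ-sumTo (outer m) m _)) ⟩
    sumTo n (λ m → outer m * (𝒟 c₁ u ⋆ v) m)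
      ≡⟨ sumTo-cong n (λ m _ → regroup (fromℕ (n !)) (c₂ - fromℕ m) (v (n ∸ m)) ((𝒟 c₁ u ⋆ v) m)) ⟩
    sumTo n (λ m → fromℕ (n !) * (𝒟 c₂ (𝒟 c₁ u ⋆ v) m * v (n ∸ m)))
      ≡⟨ *-distribˡ-sumTo (fromℕ (n !)) n _ ⟨
    fromℕ (n !) * (𝒟 c₂ (𝒟 c₁ u ⋆ v) ⋆ v) n
      ∎
  where
  open ≡-Reasoning
  u v : Seq
  u = ê N
  v = e N
  c₁ c₂ D : ℚ
  c₁ = κ N
  c₂ = κ N + κ N
  D = fromℕ (weight-denominator N)
  T : ℕ → ℕ → ℚ
  T m k = binom n m * binom m k * weight N m k * Ê N k * E N (n ∸ m) * E N (m ∸ k)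
  outer : ℕ → ℚ
  outer m = fromℕ (n !) * (c₂ - fromℕ m) * v (n ∸ m)
  regroup : ∀ F p w x → F * p * w * x ≡ F * (p * x * w)
  regroup = solve 4 (λ F p w x → F :* p :* w :* x := F :* (p :* x :* w)) refl
  collect : ∀ b₁ b₂ W A x B y C z d →
    b₁ * b₂ * W * (A * x) * (B * y) * (C * z) * d ≡ b₁ * (b₂ * (A * C) * B) * (W * d) * (x * y * z)
  collect = solve 10 (λ b₁ b₂ W A x B y C z d →
    b₁ :* b₂ :* W :* (A :* x) :* (B :* y) :* (C :* z) :* d
      := b₁ :* (b₂ :* (A :* C) :* B) :* (W :* d) :* (x :* y :* z)) refl
  spread : ∀ F p q x y z → F * (p * q) * (x * y * z) ≡ F * p * y * (q * x * z)
  spread = solve 6 (λ F p q x y z → F :* (p :* q) :* (x :* y :* z) := F :* p :* y :* (q :* x :* z)) refl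
  term : ∀ m k → m ≤ n → k ≤ m → T m k * D ≡ outer m * (𝒟 c₁ u k * v (m ∸ k))
  term m k m≤n k≤m = begin
    T m k * D
      ≡⟨ collect (binom n m) (binom m k) (weight N m k) (fromℕ (k !)) (u k)
                 (fromℕ ((n ∸ m) !)) (v (n ∸ m)) (fromℕ ((m ∸ k) !)) (v (m ∸ k)) D ⟩
    binom n m * (binom m k * (fromℕ (k !) * fromℕ ((m ∸ k) !)) * fromℕ ((n ∸ m) !))
      * (weight N m k * D) * (u k * v (n ∸ m) * v (m ∸ k))
      ≡⟨ cong₂ (λ p q → p * q * (u k * v (n ∸ m) * v (m ∸ k)))
               (trans (cong (λ x → binom n m * (x * fromℕ ((n ∸ m) !))) (binom-*-factorials k≤m)) (binom-*-factorials m≤n))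
               (weight-*-denominator N m k) ⟩
    fromℕ (n !) * ((c₂ - fromℕ m) * (c₁ - fromℕ k)) * (u k * v (n ∸ m) * v (m ∸ k))
      ≡⟨ spread (fromℕ (n !)) (c₂ - fromℕ m) (c₁ - fromℕ k) (u k) (v (n ∸ m)) (v (m ∸ k)) ⟩
    outer m * (𝒟 c₁ u k * v (m ∸ k))
      ∎

theorem7 : (N n : ℕ) → N ≥ 1 → LHS N n ≡ RHS N n
theorem7 N n _ = *-cancelʳ-fromℕ (weight-denominator N) (begin
    LHS N n * fromℕ (weight-denominator N)
      ≡⟨ cong₂ _*_ (LHS-⋆ N n) (fromℕ-weight-denominator N) ⟩
    fromℕ (n !) * (u ⋆ (u ⋆ u)) n * ((κ N + κ N) * κ N)
      ≡⟨ regroup (fromℕ (n !)) ((u ⋆ (u ⋆ u)) n) (κ N + κ N) (κ N) ⟩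
    fromℕ (n !) * ((κ N + κ N) * (κ N * (u ⋆ (u ⋆ u)) n))
      ≡⟨ cong (fromℕ (n !) *_) (cube n) ⟨
    fromℕ (n !) * (𝒟 (κ N + κ N) (𝒟 (κ N) u ⋆ v) ⋆ v) n
      ≡⟨ RHS-⋆ N n ⟨
    RHS N n * fromℕ (weight-denominator N)
      ∎)
  where
  open ≡-Reasoning
  open CubeOfReciprocal (κ N) (seriesE N) (seriesÊ N) (seriesE-zero N) (seriesÊ-zero N) (seriesÊ-seriesE N)
  regroup : ∀ F x c k → F * x * (c * k) ≡ F * (c * (k * x))
  regroup = solve 4 (λ F x c k → F :* x :* (c :* k) := F :* (c :* (k :* x))) refl
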